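{- For every integer $m\geq 2$, the windmill graph $K_4^{(m)}$ is total prime.
   Context: All graphs are finite and simple. For a graph $G$ with vertex set $V$ and edge set $E$, a total prime labeling is a bijection $\ell: V\cup E\to\{1,2,\ldots,|V|+|E|\}$ such that (i) for every pair of adjacent vertices $u,v$, $\gcd(\ell(u),\ell(v))=1$, and (ii) for every vertex $v$ of degree at least 2, the greatest common divisor of the labels $\ell(uv)$ over all edges $uv$ incident to $v$ equals 1. A graph is total prime if it admits a total prime labeling. The windmill graph $K_n^{(m)}$ consists of $m$ copies of the complete graph $K_n$ that share exactly one common vertex and are otherwise vertex-disjoint. -}

module Defs where

open import Data.Nat using (ℕ; suc)
open import Data.Nat.GCD using (gcd)
open import Data.Nat.Divisibility using (_∣_)
open import Data.Fin using (Fin; toℕ; zero; suc)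
open import Data.Fin.Base using () renaming (suc to fsuc)
open import Data.List using (List; []; _∷_; length; lookup; concatMap; allFin)
open import Data.Maybe using (Maybe; just; nothing)
open import Data.Product using (_×_; _,_; proj₁; proj₂; ∃; ∃₂)
open import Data.Sum using (_⊎_; inj₁; inj₂)
open import Function.Bundles using (Bijection)
open import Relation.Binary.PropositionalEquality using (_≡_; setoid)
open import Relation.Nullary using (¬_)

record Graph : Set₁ where
  field
    V     : Set
    edges : List (V × V)

  E : Set
  E = Fin (length edges)

  endpoints : E → V × V
  endpoints e = lookup edges e

  Incident : E → V → Set
  Incident e v = (proj₁ (endpoints e) ≡ v) ⊎ (proj₂ (endpoints e) ≡ v)

  DegreeAtLeast2 : V → Set
  DegreeAtLeast2 v = ∃₂ λ e₁ e₂ → ¬ (e₁ ≡ e₂) × Incident e₁ v × Incident e₂ v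

open Graph public

_⤖_ : Set → Set → Set
A ⤖ B = Bijection (setoid A) (setoid B)

-- A total prime labeling.  The labels are  suc (toℕ (ℓ x)) ∈ {1,…,N}  where
-- ℓ : V ⊎ E ⤖ Fin N; since ℓ is a bijection, N = |V| + |E|.
record TotalPrimeLabeling (G : Graph) : Set where
  field
    N     : ℕ
    ℓ     : (V G ⊎ E G) ⤖ Fin N

  label : V G ⊎ E G → ℕ
  label x = suc (toℕ (Bijection.to ℓ x))

  field
    vertexCond : ∀ (e : E G) →
      gcd (label (inj₁ (proj₁ (endpoints G e)))) (label (inj₁ (proj₂ (endpoints G e)))) ≡ 1
    -- (ii) for each vertex of degree ≥ 2 the gcd of the labels of its
    -- incident edges is 1, i.e. every common divisor of them equals 1
    edgeCond : ∀ (v : V G) → DegreeAtLeast2 G v →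
      ∀ (d : ℕ) → (∀ (e : E G) → Incident G e v → d ∣ label (inj₂ e)) → d ≡ 1

TotalPrime : Graph → Set
TotalPrime G = TotalPrimeLabeling G

-- The windmill graph K₄^(m): a centre (nothing) and, for each copy c < m,
-- three further vertices just (c , i), i < 3; each copy spans a K₄.
windmillK4 : ℕ → Graph
windmillK4 m = record
  { V     = Maybe (Fin m × Fin 3)
  ; edges = concatMap blade (allFin m)
  }
  where
  blade : Fin m → List (Maybe (Fin m × Fin 3) × Maybe (Fin m × Fin 3))
  blade c =
    (nothing , just (c , zero)) ∷
    (nothing , just (c , fsuc zero)) ∷
    (nothing , just (c , fsuc (fsuc zero))) ∷
    (just (c , zero) , just (c , fsuc zero)) ∷
    (just (c , zero) , just (c , fsuc (fsuc zero))) ∷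
    (just (c , fsuc zero) , just (c , fsuc (fsuc zero))) ∷ []

{-# OPTIONS --safe #-}
-- The centre gets label 1 and blade c the nine consecutive labels from 9c + 2 on. Inside its block,
-- a blade's three outer vertices take three consecutive labels starting at an odd one, so they are
-- pairwise coprime; where they sit therefore depends on the parity of 9c + 2. The edges are placed
-- so that every vertex of the blade, the centre included, is incident to two edges with consecutive
-- labels.
module Submission where

open import Defs
open import Data.Nat using (ℕ; suc; _+_; _*_; _≤_)
open import Data.Nat.Properties using (+-comm)
open import Data.Nat.Divisibility using (_∣_; _∣?_; ∣m+n∣m⇒∣n; ∣1⇒≡1)
open import Data.Nat.Coprimality using (Coprime; coprime⇒gcd≡1; 1-coprimeTo)
open import Data.Nat.Primality using (irreducible[2])
open import Data.Bool using (Bool; true; false)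
open import Data.Fin using (Fin; toℕ; zero; suc; combine; remQuot)
open import Data.Fin.Patterns using (0F; 1F; 2F; 3F; 4F; 5F; 6F; 7F; 8F)
open import Data.Fin.Properties using (remQuot-combine; combine-remQuot; toℕ-combine)
open import Data.List using (List; _++_; length; lookup; concatMap; tabulate)
open import Data.Maybe using (just; nothing)
open import Data.Product using (_×_; _,_; proj₁; proj₂; ∃₂; map₁; uncurry)
open import Data.Sum using (_⊎_; inj₁; inj₂)
open import Data.Vec using (Vec; []; _∷_; toList)
import Data.Vec as Vec
import Data.Sum as Sum
open import Function using (_∘_; id)
open import Function.Bundles using (Bijection; mk↔ₛ′)
open import Function.Properties.Inverse using (↔⇒⤖)
open import Relation.Nullary using (¬_; Dec; does; yes; no; contradiction)
open import Relation.Binary.PropositionalEquality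

private
  variable
    d k l n : ℕ

∣n∣k+n⇒∣k : d ∣ n → d ∣ k + n → d ∣ k
∣n∣k+n⇒∣k {d} {n} {k} d∣n d∣k+n = ∣m+n∣m⇒∣n (subst (d ∣_) (+-comm k n) d∣k+n) d∣n

coprime-suc : ∀ n → Coprime n (suc n)
coprime-suc n (d∣n , d∣1+n) = ∣1⇒≡1 (∣n∣k+n⇒∣k d∣n d∣1+n)

odd⇒coprime-+2 : ¬ 2 ∣ n → Coprime n (2 + n)
odd⇒coprime-+2 2∤n (d∣n , d∣2+n) with irreducible[2] (∣n∣k+n⇒∣k d∣n d∣2+n)
... | inj₁ d≡1 = d≡1
... | inj₂ refl = contradiction d∣n 2∤n

module _ {B : Set} where

  splitAt-++ : (v : Vec B k) (ys : List B) → Fin (length (toList v ++ ys)) → Fin k ⊎ Fin (length ys)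
  splitAt-++ []      ys i       = inj₂ i
  splitAt-++ (x ∷ v) ys zero    = inj₁ zero
  splitAt-++ (x ∷ v) ys (suc i) = Sum.map₁ suc (splitAt-++ v ys i)

  join-++ : (v : Vec B k) (ys : List B) → Fin k ⊎ Fin (length ys) → Fin (length (toList v ++ ys))
  join-++ []      ys (inj₂ i)       = i
  join-++ (x ∷ v) ys (inj₁ zero)    = zero
  join-++ (x ∷ v) ys (inj₁ (suc j)) = suc (join-++ v ys (inj₁ j))
  join-++ (x ∷ v) ys (inj₂ i)       = suc (join-++ v ys (inj₂ i))

  splitAt-join-++ : ∀ (v : Vec B k) ys s → splitAt-++ v ys (join-++ v ys s) ≡ s
  splitAt-join-++ []      ys (inj₂ i)       = refl
  splitAt-join-++ (x ∷ v) ys (inj₁ zero)    = refl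
  splitAt-join-++ (x ∷ v) ys (inj₁ (suc j)) = cong (Sum.map₁ suc) (splitAt-join-++ v ys (inj₁ j))
  splitAt-join-++ (x ∷ v) ys (inj₂ i)       = cong (Sum.map₁ suc) (splitAt-join-++ v ys (inj₂ i))

  join-splitAt-++ : ∀ (v : Vec B k) ys i → join-++ v ys (splitAt-++ v ys i) ≡ i
  join-splitAt-++ []      ys i       = refl
  join-splitAt-++ (x ∷ v) ys zero    = refl
  join-splitAt-++ (x ∷ v) ys (suc i) with splitAt-++ v ys i | join-splitAt-++ v ys i
  ... | inj₁ j | eq = cong suc eq
  ... | inj₂ j | eq = cong suc eq

  lookup-join-++ : ∀ (v : Vec B k) ys s →
                   lookup (toList v ++ ys) (join-++ v ys s) ≡ Sum.[ Vec.lookup v , lookup ys ] s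
  lookup-join-++ []      ys (inj₂ i)       = refl
  lookup-join-++ (x ∷ v) ys (inj₁ zero)    = refl
  lookup-join-++ (x ∷ v) ys (inj₁ (suc j)) = lookup-join-++ v ys (inj₁ j)
  lookup-join-++ (x ∷ v) ys (inj₂ i)       = lookup-join-++ v ys (inj₂ i)

module _ {A B : Set} (f : A → Vec B k) where

  blocks : (Fin n → A) → List B
  blocks g = concatMap (toList ∘ f) (tabulate g)

  combineBlocks : (g : Fin n → A) → Fin n → Fin k → Fin (length (blocks g))
  combineBlocks g zero    j = join-++ (f (g zero)) (blocks (g ∘ suc)) (inj₁ j)
  combineBlocks g (suc c) j =
    join-++ (f (g zero)) (blocks (g ∘ suc)) (inj₂ (combineBlocks (g ∘ suc) c j))

  remQuot-∷ : (Fin l → Fin n × Fin k) → Fin k ⊎ Fin l → Fin (suc n) × Fin k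
  remQuot-∷ r = Sum.[ (zero ,_) , map₁ suc ∘ r ]

  remQuotBlocks : (g : Fin n → A) → Fin (length (blocks g)) → Fin n × Fin k
  remQuotBlocks {suc n} g i =
    remQuot-∷ (remQuotBlocks (g ∘ suc)) (splitAt-++ (f (g zero)) (blocks (g ∘ suc)) i)

  remQuot-combineBlocks : ∀ (g : Fin n → A) c j → remQuotBlocks g (combineBlocks g c j) ≡ (c , j)
  remQuot-combineBlocks g zero j =
    cong (remQuot-∷ (remQuotBlocks (g ∘ suc))) (splitAt-join-++ (f (g zero)) (blocks (g ∘ suc)) (inj₁ j))
  remQuot-combineBlocks g (suc c) j = trans
    (cong (remQuot-∷ (remQuotBlocks (g ∘ suc))) (splitAt-join-++ (f (g zero)) (blocks (g ∘ suc)) (inj₂ _)))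
    (cong (map₁ suc) (remQuot-combineBlocks (g ∘ suc) c j))

  combine-remQuotBlocks : ∀ (g : Fin n → A) i → uncurry (combineBlocks g) (remQuotBlocks g i) ≡ i
  combine-remQuotBlocks {suc n} g i = trans (combine-split (splitAt-++ v ys i)) (join-splitAt-++ v ys i)
    where
    v : Vec B k
    v = f (g zero)
    ys : List B
    ys = blocks (g ∘ suc)
    combine-split : ∀ s → uncurry (combineBlocks g) (remQuot-∷ (remQuotBlocks (g ∘ suc)) s) ≡ join-++ v ys s
    combine-split (inj₁ j) = refl
    combine-split (inj₂ x) = cong (join-++ v ys ∘ inj₂) (combine-remQuotBlocks (g ∘ suc) x)

  lookup-combineBlocks : ∀ (g : Fin n → A) c j →
                         lookup (blocks g) (combineBlocks g c j) ≡ Vec.lookup (f (g c)) j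
  lookup-combineBlocks g zero    j = lookup-join-++ (f (g zero)) (blocks (g ∘ suc)) (inj₁ j)
  lookup-combineBlocks g (suc c) j =
    trans (lookup-join-++ (f (g zero)) (blocks (g ∘ suc)) (inj₂ _)) (lookup-combineBlocks (g ∘ suc) c j)

module Labeling (G : Graph) {N : ℕ} (ℓ : (V G ⊎ E G) ⤖ Fin N) where

  label : V G ⊎ E G → ℕ
  label x = suc (toℕ (Bijection.to ℓ x))

  HasCoprimeIncidentEdges : V G → Set
  HasCoprimeIncidentEdges v =
    ∃₂ λ e₁ e₂ → Incident G e₁ v × Incident G e₂ v × Coprime (label (inj₂ e₁)) (label (inj₂ e₂))

  totalPrimeLabeling :
    (∀ e → Coprime (label (inj₁ (proj₁ (endpoints G e)))) (label (inj₁ (proj₂ (endpoints G e))))) →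
    (∀ v → DegreeAtLeast2 G v → HasCoprimeIncidentEdges v) →
    TotalPrimeLabeling G
  totalPrimeLabeling adjacent-coprime incident-coprime = record
    { N          = N
    ; ℓ          = ℓ
    ; vertexCond = coprime⇒gcd≡1 ∘ adjacent-coprime
    ; edgeCond   = edgeCond
    }
    where
    edgeCond : ∀ v → DegreeAtLeast2 G v → ∀ d → (∀ e → Incident G e v → d ∣ label (inj₂ e)) → d ≡ 1
    edgeCond v deg d d∣ with incident-coprime v deg
    ... | e₁ , e₂ , e₁∋v , e₂∋v , coprime = coprime (d∣ e₁ e₁∋v , d∣ e₂ e₂∋v)

-- The flag says whether the block starts at an even label. Edges are numbered as in bladeEdges
-- below; the pairs 0,1 / 4,0 / 1,5 / 5,2, incident to the centre and to vertices 0, 1, 2, occupy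
-- consecutive slots for either flag.
layout : Bool → Fin 3 ⊎ Fin 6 → Fin 9
layout _     (inj₂ 0F) = 5F
layout _     (inj₂ 1F) = 6F
layout _     (inj₂ 2F) = 8F
layout _     (inj₂ 4F) = 4F
layout _     (inj₂ 5F) = 7F
layout true  (inj₂ 3F) = 0F
layout false (inj₂ 3F) = 3F
layout true  (inj₁ 0F) = 1F
layout true  (inj₁ 1F) = 2F
layout true  (inj₁ 2F) = 3F
layout false (inj₁ 0F) = 0F
layout false (inj₁ 1F) = 1F
layout false (inj₁ 2F) = 2F

unlayout : Bool → Fin 9 → Fin 3 ⊎ Fin 6
unlayout _     4F = inj₂ 4F
unlayout _     5F = inj₂ 0F
unlayout _     6F = inj₂ 1F
unlayout _     7F = inj₂ 5F
unlayout _     8F = inj₂ 2F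
unlayout true  0F = inj₂ 3F
unlayout true  1F = inj₁ 0F
unlayout true  2F = inj₁ 1F
unlayout true  3F = inj₁ 2F
unlayout false 0F = inj₁ 0F
unlayout false 1F = inj₁ 1F
unlayout false 2F = inj₁ 2F
unlayout false 3F = inj₂ 3F

layout-unlayout : ∀ b j → layout b (unlayout b j) ≡ j
layout-unlayout _     4F = refl
layout-unlayout _     5F = refl
layout-unlayout _     6F = refl
layout-unlayout _     7F = refl
layout-unlayout _     8F = refl
layout-unlayout true  0F = refl
layout-unlayout true  1F = refl
layout-unlayout true  2F = refl
layout-unlayout true  3F = refl
layout-unlayout false 0F = refl
layout-unlayout false 1F = refl
layout-unlayout false 2F = refl
layout-unlayout false 3F = refl

unlayout-layout : ∀ b s → unlayout b (layout b s) ≡ s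
unlayout-layout _     (inj₂ 0F) = refl
unlayout-layout _     (inj₂ 1F) = refl
unlayout-layout _     (inj₂ 2F) = refl
unlayout-layout _     (inj₂ 4F) = refl
unlayout-layout _     (inj₂ 5F) = refl
unlayout-layout true  (inj₂ 3F) = refl
unlayout-layout false (inj₂ 3F) = refl
unlayout-layout true  (inj₁ 0F) = refl
unlayout-layout true  (inj₁ 1F) = refl
unlayout-layout true  (inj₁ 2F) = refl
unlayout-layout false (inj₁ 0F) = refl
unlayout-layout false (inj₁ 1F) = refl
unlayout-layout false (inj₁ 2F) = refl

firstVertexSlot : Bool → ℕ
firstVertexSlot true  = 1
firstVertexSlot false = 0

toℕ-layout-vertex : ∀ b i s → toℕ (layout b (inj₁ i)) + s ≡ toℕ i + (firstVertexSlot b + s)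
toℕ-layout-vertex true  0F s = refl
toℕ-layout-vertex true  1F s = refl
toℕ-layout-vertex true  2F s = refl
toℕ-layout-vertex false 0F s = refl
toℕ-layout-vertex false 1F s = refl
toℕ-layout-vertex false 2F s = refl

firstVertexLabel : ℕ → ℕ
firstVertexLabel s = firstVertexSlot (does (2 ∣? s)) + s

firstVertexLabel-odd : ∀ s → ¬ 2 ∣ firstVertexLabel s
firstVertexLabel-odd s = odd (2 ∣? s)
  where
  odd : (2∣?s : Dec (2 ∣ s)) → ¬ 2 ∣ firstVertexSlot (does 2∣?s) + s
  odd (yes 2∣s) 2∣1+s = contradiction (coprime-suc s (2∣s , 2∣1+s)) λ ()
  odd (no  2∤s)       = 2∤s

module Windmill (m : ℕ) where

  G : Graph
  G = windmillK4 m

  Vertex : Set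
  Vertex = V G

  Edge : Set
  Edge = E G

  bladeEdges : Fin m → Vec (Vertex × Vertex) 6
  bladeEdges c =
    (nothing , just (c , 0F)) ∷ (nothing , just (c , 1F)) ∷ (nothing , just (c , 2F)) ∷
    (just (c , 0F) , just (c , 1F)) ∷ (just (c , 0F) , just (c , 2F)) ∷
    (just (c , 1F) , just (c , 2F)) ∷ []

  edge : Fin m → Fin 6 → Edge
  edge = combineBlocks bladeEdges id

  bladeOf : Edge → Fin m × Fin 6
  bladeOf = remQuotBlocks bladeEdges id

  edge-bladeOf : ∀ e → uncurry edge (bladeOf e) ≡ e
  edge-bladeOf = combine-remQuotBlocks bladeEdges id

  endpoints-edge : ∀ c k → endpoints G (edge c k) ≡ Vec.lookup (bladeEdges c) k
  endpoints-edge = lookup-combineBlocks bladeEdges id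

  blockStart : Fin m → ℕ
  blockStart c = 2 + 9 * toℕ c

  startsEven : Fin m → Bool
  startsEven c = does (2 ∣? blockStart c)

  slot : Fin m → Fin 3 ⊎ Fin 6 → Fin (m * 9)
  slot c s = combine c (layout (startsEven c) s)

  part : Fin m → Fin 3 ⊎ Fin 6 → Vertex ⊎ Edge
  part c (inj₁ i) = inj₁ (just (c , i))
  part c (inj₂ k) = inj₂ (edge c k)

  edgeSlot : Fin m × Fin 6 → Fin (m * 9)
  edgeSlot (c , k) = slot c (inj₂ k)

  unslot : Fin m × Fin 9 → Vertex ⊎ Edge
  unslot (c , r) = part c (unlayout (startsEven c) r)

  to : Vertex ⊎ Edge → Fin (suc (m * 9))
  to (inj₁ nothing)        = zero
  to (inj₁ (just (c , i))) = suc (slot c (inj₁ i))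
  to (inj₂ e)              = suc (edgeSlot (bladeOf e))

  from : Fin (suc (m * 9)) → Vertex ⊎ Edge
  from zero    = inj₁ nothing
  from (suc j) = unslot (remQuot 9 j)

  to-part : ∀ c s → to (part c s) ≡ suc (slot c s)
  to-part c (inj₁ i) = refl
  to-part c (inj₂ k) = cong (suc ∘ edgeSlot) (remQuot-combineBlocks bladeEdges id c k)

  from-slot : ∀ c s → from (suc (slot c s)) ≡ part c s
  from-slot c s = begin
    unslot (remQuot 9 (slot c s))                              ≡⟨ cong unslot (remQuot-combine c _) ⟩
    part c (unlayout (startsEven c) (layout (startsEven c) s)) ≡⟨ cong (part c) (unlayout-layout (startsEven c) s) ⟩
    part c s                                                   ∎
    where open ≡-Reasoning

  to-from : ∀ j → to (from j) ≡ j
  to-from zero    = refl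
  to-from (suc j) = begin
    to (part c (unlayout (startsEven c) r))                           ≡⟨ to-part c _ ⟩
    suc (combine c (layout (startsEven c) (unlayout (startsEven c) r))) ≡⟨ cong (suc ∘ combine c)
                                                                             (layout-unlayout (startsEven c) r) ⟩
    suc (combine c r)                                                   ≡⟨ cong suc (combine-remQuot {m} 9 j) ⟩
    suc j                                                               ∎
    where
    open ≡-Reasoning
    c : Fin m
    c = proj₁ (remQuot {m} 9 j)
    r : Fin 9
    r = proj₂ (remQuot {m} 9 j)

  from-to : ∀ x → from (to x) ≡ x
  from-to (inj₁ nothing)        = refl
  from-to (inj₁ (just (c , i))) = from-slot c (inj₁ i)
  from-to (inj₂ e)              =
    trans (from-slot (proj₁ (bladeOf e)) (inj₂ (proj₂ (bladeOf e)))) (cong inj₂ (edge-bladeOf e))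

  bijection : (Vertex ⊎ Edge) ⤖ Fin (suc (m * 9))
  bijection = ↔⇒⤖ (mk↔ₛ′ to from to-from from-to)

  open Labeling G bijection

  label-part : ∀ c s → label (part c s) ≡ toℕ (layout (startsEven c) s) + blockStart c
  label-part c s = begin
    suc (toℕ (to (part c s)))                    ≡⟨ cong (suc ∘ toℕ) (to-part c s) ⟩
    2 + toℕ (combine c (layout (startsEven c) s)) ≡⟨ cong (2 +_) (toℕ-combine c _) ⟩
    blockStart c + toℕ (layout (startsEven c) s)  ≡⟨ +-comm (blockStart c) _ ⟩
    toℕ (layout (startsEven c) s) + blockStart c  ∎
    where open ≡-Reasoning

  AdjacentCoprime : Vertex × Vertex → Set
  AdjacentCoprime (u , v) = Coprime (label (inj₁ u)) (label (inj₁ v))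

  label-vertex : ∀ c i → label (inj₁ (just (c , i))) ≡ toℕ i + firstVertexLabel (blockStart c)
  label-vertex c i = trans (label-part c (inj₁ i)) (toℕ-layout-vertex (startsEven c) i (blockStart c))

  vertices-coprime : ∀ c i j →
    Coprime (toℕ i + firstVertexLabel (blockStart c)) (toℕ j + firstVertexLabel (blockStart c)) →
    AdjacentCoprime (just (c , i) , just (c , j))
  vertices-coprime c i j = subst₂ Coprime (sym (label-vertex c i)) (sym (label-vertex c j))

  blade-adjacent-coprime : ∀ c k → AdjacentCoprime (Vec.lookup (bladeEdges c) k)
  blade-adjacent-coprime c 0F = 1-coprimeTo _
  blade-adjacent-coprime c 1F = 1-coprimeTo _
  blade-adjacent-coprime c 2F = 1-coprimeTo _
  blade-adjacent-coprime c 3F = vertices-coprime c 0F 1F (coprime-suc _)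
  blade-adjacent-coprime c 4F =
    vertices-coprime c 0F 2F (odd⇒coprime-+2 (firstVertexLabel-odd (blockStart c)))
  blade-adjacent-coprime c 5F = vertices-coprime c 1F 2F (coprime-suc _)

  edge-adjacent-coprime : ∀ c k → AdjacentCoprime (endpoints G (edge c k))
  edge-adjacent-coprime c k =
    subst AdjacentCoprime (sym (endpoints-edge c k)) (blade-adjacent-coprime c k)

  adjacent-coprime : ∀ e → AdjacentCoprime (endpoints G e)
  adjacent-coprime e =
    subst (AdjacentCoprime ∘ endpoints G) (edge-bladeOf e) (uncurry edge-adjacent-coprime (bladeOf e))

  source : ∀ c k → Incident G (edge c k) (proj₁ (Vec.lookup (bladeEdges c) k))
  source c k = inj₁ (cong proj₁ (endpoints-edge c k))

  target : ∀ c k → Incident G (edge c k) (proj₂ (Vec.lookup (bladeEdges c) k))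
  target c k = inj₂ (cong proj₂ (endpoints-edge c k))

  consecutive-incident-edges :
    ∀ {v} c k₁ k₂ → Incident G (edge c k₁) v → Incident G (edge c k₂) v →
    toℕ (layout (startsEven c) (inj₂ k₂)) ≡ suc (toℕ (layout (startsEven c) (inj₂ k₁))) →
    HasCoprimeIncidentEdges v
  consecutive-incident-edges c k₁ k₂ e₁∋v e₂∋v consecutive =
    edge c k₁ , edge c k₂ , e₁∋v , e₂∋v ,
    subst₂ Coprime (sym (label-part c (inj₂ k₁))) (sym (label-part c (inj₂ k₂)))
      (subst (Coprime _) (cong (_+ blockStart c) (sym consecutive)) (coprime-suc _))

  incident-coprime : ∀ v → DegreeAtLeast2 G v → HasCoprimeIncidentEdges v
  incident-coprime nothing          (e , _) = consecutive-incident-edges c 0F 1F (source c 0F) (source c 1F) refl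
    where
    c : Fin m
    c = proj₁ (bladeOf e)
  incident-coprime (just (c , 0F)) _       = consecutive-incident-edges c 4F 0F (source c 4F) (target c 0F) refl
  incident-coprime (just (c , 1F)) _       = consecutive-incident-edges c 1F 5F (target c 1F) (source c 5F) refl
  incident-coprime (just (c , 2F)) _       = consecutive-incident-edges c 5F 2F (target c 5F) (target c 2F) refl

-- The labeling works for every m.
mainTheorem8 : ∀ (m : ℕ) → 2 ≤ m → TotalPrime (windmillK4 m)
mainTheorem8 m _ = totalPrimeLabeling adjacent-coprime incident-coprime
  where
  open Windmill m
  open Labeling G bijection
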